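{- Let $f_1,\dots,f_n$ be a structural equation model over Boolean variables $X_1,\dots,X_n$, where $X_i=f_i(X_1,\dots,X_{i-1})$, and let $E$ be an effect set of valuations of $X_1,\dots,X_n$ containing the valuation obtained by evaluating the equations. Let $X\subseteq\{X_1,\dots,X_n\}$ be a but-for-cause for $E$. Let $C_X$ be the set of all nodes of the transition system $\mathcal{T}$ (defined below) that are reached by a $\mathsf{default}$-transition for a variable $x\in X$. Then $C_X$ is a $d_{\mathit{Hamm}}$-counterfactual cause for $\lozenge E$ in $\mathcal{T}$ on the default path $\pi$.
   Context: But-for-cause: a minimal subset $X\subseteq\{X_1,\dots,X_n\}$ such that there are values $\alpha_x$ for $x\in X$ with the following property: defining $w_i=f_i(w_1,\dots,w_{i-1})$ if $X_i\notin X$ and $w_i=\alpha_{X_i}$ if $X_i\in X$, the valuation $[X_1=w_1,\dots,X_n=w_n]$ is not in $E$. The tree-like transition system $\mathcal{T}$: the nodes at level $i$ ($1\le i\le n+1$) are valuations of $X_1,\dots,X_{i-1}$; the initial node is the empty valuation. From a node $s$ at level $i\le n$ there are two transitions: the $\mathsf{default}$ transition to the node at level $i+1$ extending $s$ by $X_i=f_i(\cdot)$ evaluated on the values in $s$, and the $\mathsf{intervention}$ transition to the node extending $s$ by setting $X_i$ to the other Boolean value. Nodes reached by an $\mathsf{intervention}$ transition are labeled $\{\mathsf{intervention}\}$; all other nodes (including the initial one) are labeled $\emptyset$. $E$ is identified with the corresponding set of leaves (level $n+1$). The default path $\pi$ always takes $\mathsf{default}$ transitions. A maximal path is a path from the initial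 node to a leaf; a path satisfies $\lozenge E$ if it visits $E$. For maximal paths $\pi,\rho$ (all of length $n+1$), $d_{\mathit{Hamm}}(\pi,\rho)$ is the number of positions at which their label sequences differ. For a maximal path $\pi$ visiting $C$ and satisfying $\lozenge E$, $C$ is a $d_{\mathit{Hamm}}$-counterfactual cause for $\lozenge E$ on $\pi$ if (1) some maximal path does not visit $C$, and (2) every maximal path $\rho$ not visiting $C$ with $d_{\mathit{Hamm}}(\pi,\rho)$ minimal among maximal paths not visiting $C$ does not visit $E$. -}

module Defs where

open import Data.Bool using (Bool; true; false; not; if_then_else_; _xor_)
open import Data.Nat using (ℕ; zero; suc; _≤_; _<_; _+_)
open import Data.Vec using (Vec; []; _∷_; _∷ʳ_; init; last)
open import Data.Fin.Subset using (Subset; _⊂_)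
open import Data.Product using (Σ; ∃; _×_; _,_)
open import Data.Empty using (⊥)
open import Relation.Binary.PropositionalEquality using (_≡_; subst)
open import Relation.Nullary using (¬_)

-- The equation for variable X_{i+1} (0-based index i) is  f i : Vec Bool i → Bool,
-- taking the values of X₁,…,X_i (in order).  Only the entries i < n are ever used.
SEM : Set
SEM = (i : ℕ) → Vec Bool i → Bool

lookupD : ∀ {A : Set} {m} → A → Vec A m → ℕ → A
lookupD d []       _       = d
lookupD d (x ∷ xs) zero    = x
lookupD d (x ∷ xs) (suc i) = lookupD d xs i

build : ((i : ℕ) → Vec Bool i → Bool) → (k : ℕ) → Vec Bool k
build g zero    = []
build g (suc k) = build g k ∷ʳ g k (build g k)

intervene : ∀ {n} → SEM → Subset n → Vec Bool n → (i : ℕ) → Vec Bool i → Bool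
intervene f X α i s = if lookupD false X i then lookupD false α i else f i s

HasButForProperty : ∀ n → SEM → (Vec Bool n → Set) → Subset n → Set
HasButForProperty n f E X = ∃ λ (α : Vec Bool n) → ¬ E (build (intervene f X α) n)

ButForCause : ∀ n → SEM → (Vec Bool n → Set) → Subset n → Set
ButForCause n f E X =
  HasButForProperty n f E X × (∀ (Y : Subset n) → Y ⊂ X → ¬ HasButForProperty n f E Y)

-- The tree-like transition system 𝒯.
-- A node at level k+1 is a valuation of X₁,…,X_k, i.e. an element (k , v).
Node : Set
Node = Σ ℕ (Vec Bool)

data Action : Set where
  default      : Action
  intervention : Action

data Label : Set where
  unlabeled          : Label
  labelIntervention  : Label

applyAction : Action → Bool → Bool
applyAction default      b = b
applyAction intervention b = not b

-- A node is labeled {intervention} iff it is reached by an intervention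
-- transition, i.e. its last value differs from the equation's value.
label : SEM → Node → Label
label f (zero , v)  = unlabeled
label f (suc j , v) = if last v xor f j (init v) then labelIntervention else unlabeled

-- A maximal path from the initial node is given by the sequence of the
-- n transitions it takes.
MaxPath : ℕ → Set
MaxPath n = Vec Action n

pathStep : ∀ {n} → SEM → MaxPath n → (i : ℕ) → Vec Bool i → Bool
pathStep f ρ i s = applyAction (lookupD default ρ i) (f i s)

nodeAt : ∀ {n} → SEM → MaxPath n → ℕ → Node
nodeAt f ρ k = k , build (pathStep f ρ) k

Visits : ∀ {n} → SEM → MaxPath n → (Node → Set) → Set
Visits {n} f ρ P = ∃ λ k → k ≤ n × P (nodeAt f ρ k)

labelsUpTo : ∀ {n} → SEM → MaxPath n → (k : ℕ) → Vec Label (suc k)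
labelsUpTo f ρ zero    = label f (nodeAt f ρ zero) ∷ []
labelsUpTo f ρ (suc k) = labelsUpTo f ρ k ∷ʳ label f (nodeAt f ρ (suc k))

labelDiff : Label → Label → ℕ
labelDiff unlabeled         unlabeled         = 0
labelDiff labelIntervention labelIntervention = 0
labelDiff _                 _                 = 1

hamming : ∀ {m} → Vec Label m → Vec Label m → ℕ
hamming []       []       = 0
hamming (a ∷ as) (b ∷ bs) = labelDiff a b + hamming as bs

dHamm : ∀ {n} → SEM → MaxPath n → MaxPath n → ℕ
dHamm {n} f π ρ = hamming (labelsUpTo f π n) (labelsUpTo f ρ n)

LeafSet : ∀ n → (Vec Bool n → Set) → Node → Set
LeafSet n E (k , v) = ∃ λ (eq : k ≡ n) → E (subst (Vec Bool) eq v)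

CounterfactualCause : ∀ n → SEM → (Node → Set) → (Node → Set) → MaxPath n → Set
CounterfactualCause n f C EN π =
    Visits f π C
  × Visits f π EN
  × (∃ λ (ρ : MaxPath n) → ¬ Visits f ρ C)
  × (∀ (ρ : MaxPath n) → ¬ Visits f ρ C
       → (∀ (ρ' : MaxPath n) → ¬ Visits f ρ' C → dHamm f π ρ ≤ dHamm f π ρ')
       → ¬ Visits f ρ EN)

defaultPath : ∀ n → MaxPath n
defaultPath zero    = []
defaultPath (suc n) = default ∷ defaultPath n

CX : ∀ n → SEM → Subset n → Node → Set
CX n f X (zero , v)  = ⊥
CX n f X (suc j , v) = j < n × lookupD false X j ≡ true × last v ≡ f j (init v)

-- A path avoids C_X exactly when it intervenes on every variable of X, and its
-- Hamming distance to the default path is its number of interventions.  A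
-- closest such path therefore intervenes on X and nowhere else: resetting an
-- intervention outside X keeps C_X avoided and lowers the distance.  Its leaf
-- is the outcome of the intervention X := α of the but-for cause, because
-- minimality of X forces every α_x to differ from the value the equation of x
-- would produce; so that leaf lies outside E.
module Submission where

open import Defs
open import Data.Nat using (ℕ)
open import Data.Bool using (Bool)
open import Data.Vec using (Vec)
open import Data.Fin.Subset using (Subset)

open import Data.Bool using (true; false; not; if_then_else_; _xor_)
open import Data.Bool.Properties using (¬-not; not-¬)
open import Data.Nat using (zero; suc; _≤_; _<_; z≤n; s≤s)
open import Data.Nat.Properties using (≤-refl; n<1+n; m<n⇒m<1+n; <-≤-trans; <-irrefl; _≟_)
open import Data.Vec using ([]; _∷_; _∷ʳ_; init; last; map; lookup)
open import Data.Vec.Properties using (init-∷ʳ; last-∷ʳ; []=⇒lookup; lookup⇒[]=)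
open import Data.Fin using (Fin; toℕ; fromℕ<)
open import Data.Fin.Properties using (toℕ-fromℕ<)
open import Data.Fin.Subset using (_⊂_; _∈_)
open import Data.Product using (∃; _×_; _,_)
open import Data.Sum using (_⊎_; inj₁; inj₂)
open import Data.Empty using (⊥-elim)
open import Function.Bundles using (_⇔_; mk⇔; Equivalence)
open import Relation.Nullary using (¬_; yes; no)
open import Relation.Binary.PropositionalEquality
open ≡-Reasoning

build-cong : ∀ {g h : (i : ℕ) → Vec Bool i → Bool} k →
  (∀ i → i < k → build g i ≡ build h i → g i (build g i) ≡ h i (build g i)) →
  build g k ≡ build h k
build-cong zero step = refl
build-cong {g} {h} (suc k) step =
  cong₂ _∷ʳ_ prefix (trans (step k (n<1+n k) prefix) (cong (h k) prefix))
  where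
  prefix : build g k ≡ build h k
  prefix = build-cong k (λ i i<k → step i (m<n⇒m<1+n i<k))

setAt : ∀ {A : Set} {m} → ℕ → A → Vec A m → Vec A m
setAt i       v []       = []
setAt zero    v (x ∷ xs) = v ∷ xs
setAt (suc i) v (x ∷ xs) = x ∷ setAt i v xs

lookupD-setAt-≡ : ∀ {A : Set} {m} (d : A) (xs : Vec A m) i → lookupD d (setAt i d xs) i ≡ d
lookupD-setAt-≡ d []       i       = refl
lookupD-setAt-≡ d (x ∷ xs) zero    = refl
lookupD-setAt-≡ d (x ∷ xs) (suc i) = lookupD-setAt-≡ d xs i

lookupD-setAt-≢ : ∀ {A : Set} {m} (d v : A) (xs : Vec A m) {i j} → j ≢ i →
  lookupD d (setAt i v xs) j ≡ lookupD d xs j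
lookupD-setAt-≢ d v []       {i}     {j}     j≢i = refl
lookupD-setAt-≢ d v (x ∷ xs) {zero}  {zero}  j≢i = ⊥-elim (j≢i refl)
lookupD-setAt-≢ d v (x ∷ xs) {zero}  {suc j} j≢i = refl
lookupD-setAt-≢ d v (x ∷ xs) {suc i} {zero}  j≢i = refl
lookupD-setAt-≢ d v (x ∷ xs) {suc i} {suc j} j≢i = lookupD-setAt-≢ d v xs (λ j≡i → j≢i (cong suc j≡i))

lookupD-toℕ : ∀ {A : Set} {m} (d : A) (xs : Vec A m) (x : Fin m) → lookupD d xs (toℕ x) ≡ lookup xs x
lookupD-toℕ d (y ∷ xs) Fin.zero    = refl
lookupD-toℕ d (y ∷ xs) (Fin.suc x) = lookupD-toℕ d xs x

lookupD-map : ∀ {A B : Set} {m} (g : A → B) (d : A) (xs : Vec A m) j →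
  lookupD (g d) (map g xs) j ≡ g (lookupD d xs j)
lookupD-map g d []       j       = refl
lookupD-map g d (x ∷ xs) zero    = refl
lookupD-map g d (x ∷ xs) (suc j) = lookupD-map g d xs j

some-true-or-all-false : ∀ {m} (xs : Vec Bool m) →
  (∃ λ j → j < m × lookupD false xs j ≡ true) ⊎ (∀ j → lookupD false xs j ≡ false)
some-true-or-all-false []          = inj₂ (λ j → refl)
some-true-or-all-false (true ∷ xs) = inj₁ (zero , s≤s z≤n , refl)
some-true-or-all-false (false ∷ xs) with some-true-or-all-false xs
... | inj₁ (j , j<m , xsj) = inj₁ (suc j , s≤s j<m , xsj)
... | inj₂ none            = inj₂ λ { zero → refl ; (suc j) → none j }

∈⇔lookupD : ∀ {m} (x : Fin m) (S : Subset m) → x ∈ S ⇔ (lookupD false S (toℕ x) ≡ true)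
∈⇔lookupD x S = mk⇔ (λ x∈S → trans (lookupD-toℕ false S x) ([]=⇒lookup x∈S))
                    (λ Sx → lookup⇒[]= x S (trans (sym (lookupD-toℕ false S x)) Sx))

setAt-false-⊂ : ∀ {m} (X : Subset m) {i} → i < m → lookupD false X i ≡ true → setAt i false X ⊂ X
setAt-false-⊂ X {i} i<m Xi = ⊆ , fromℕ< i<m , i∈X , i∉Y
  where
  open Equivalence
  Y : Subset _
  Y = setAt i false X

  false-at-i : lookupD false Y i ≢ true
  false-at-i Yi with trans (sym (lookupD-setAt-≡ false X i)) Yi
  ... | ()

  ⊆ : ∀ {y} → y ∈ Y → y ∈ X
  ⊆ {y} y∈Y with toℕ y ≟ i
  ... | yes refl = ⊥-elim (false-at-i (to (∈⇔lookupD y Y) y∈Y))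
  ... | no y≢i   = from (∈⇔lookupD y X)
                     (trans (sym (lookupD-setAt-≢ false false X y≢i)) (to (∈⇔lookupD y Y) y∈Y))

  i∈X : fromℕ< i<m ∈ X
  i∈X = from (∈⇔lookupD _ X) (trans (cong (lookupD false X) (toℕ-fromℕ< i<m)) Xi)

  i∉Y : ¬ fromℕ< i<m ∈ Y
  i∉Y i∈Y = false-at-i (trans (cong (lookupD false Y) (sym (toℕ-fromℕ< i<m))) (to (∈⇔lookupD _ Y) i∈Y))

actionLabel : Action → Label
actionLabel default      = unlabeled
actionLabel intervention = labelIntervention

toAction : Bool → Action
toAction false = default
toAction true  = intervention

actionsOf : ∀ {m} → Subset m → MaxPath m
actionsOf = map toAction

interventions : ∀ {m} → MaxPath m → ℕ
interventions []                 = 0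
interventions (default ∷ ρ)      = interventions ρ
interventions (intervention ∷ ρ) = suc (interventions ρ)

IntervenesOn : ∀ {n} → Subset n → MaxPath n → Set
IntervenesOn {n} X ρ = ∀ j → j < n → lookupD false X j ≡ true → lookupD default ρ j ≡ intervention

applyAction-fixes⇔ : ∀ a c → (applyAction a c ≡ c) ⇔ (a ≡ default)
applyAction-fixes⇔ a c = mk⇔ (to a) (λ { refl → refl })
  where
  to : ∀ a → applyAction a c ≡ c → a ≡ default
  to default       _      = refl
  to intervention notc≡c = ⊥-elim (not-¬ refl (sym notc≡c))

applyAction-xor : ∀ a c → (if applyAction a c xor c then labelIntervention else unlabeled) ≡ actionLabel a
applyAction-xor default      false = refl
applyAction-xor default      true  = refl
applyAction-xor intervention false = refl
applyAction-xor intervention true  = refl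

lookupD-defaultPath : ∀ n j → lookupD default (defaultPath n) j ≡ default
lookupD-defaultPath zero    j       = refl
lookupD-defaultPath (suc n) zero    = refl
lookupD-defaultPath (suc n) (suc j) = lookupD-defaultPath n j

lookupD-actionsOf : ∀ {m} (X : Subset m) j → lookupD default (actionsOf X) j ≡ toAction (lookupD false X j)
lookupD-actionsOf X = lookupD-map toAction false X

intervenesOn-actionsOf : ∀ {n} (X : Subset n) → IntervenesOn X (actionsOf X)
intervenesOn-actionsOf X j _ Xj = trans (lookupD-actionsOf X j) (cong toAction Xj)

interventions-setAt-default : ∀ {m} (ρ : MaxPath m) j → lookupD default ρ j ≡ intervention →
  interventions (setAt j default ρ) < interventions ρ
interventions-setAt-default []                 j       ()
interventions-setAt-default (default ∷ ρ)      zero    ()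
interventions-setAt-default (intervention ∷ ρ) zero    _  = n<1+n (interventions ρ)
interventions-setAt-default (default ∷ ρ)      (suc j) ρj = interventions-setAt-default ρ j ρj
interventions-setAt-default (intervention ∷ ρ) (suc j) ρj = s≤s (interventions-setAt-default ρ j ρj)

closest-intervener-on-X : ∀ {n} (X : Subset n) (ρ : MaxPath n) → IntervenesOn X ρ →
  (∀ ρ' → IntervenesOn X ρ' → interventions ρ ≤ interventions ρ') →
  ∀ j → j < n → lookupD default ρ j ≡ toAction (lookupD false X j)
closest-intervener-on-X X ρ onX closest j j<n with lookupD false X j in Xj
... | true = onX j j<n Xj
... | false with lookupD default ρ j in ρj
...   | default      = refl
...   | intervention = ⊥-elim (<-irrefl refl (<-≤-trans fewer (closest ρ' onX')))
  where
  ρ' : MaxPath _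
  ρ' = setAt j default ρ

  fewer : interventions ρ' < interventions ρ
  fewer = interventions-setAt-default ρ j ρj

  onX' : IntervenesOn X ρ'
  onX' i i<n Xi with i ≟ j
  ... | no i≢j   = trans (lookupD-setAt-≢ default default ρ i≢j) (onX i i<n Xi)
  ... | yes refl with trans (sym Xj) Xi
  ...   | ()

module _ (f : SEM) where

  build-pathStep-cong : ∀ {m n} (ρ : MaxPath m) (σ : MaxPath n) k →
    (∀ j → j < k → lookupD default ρ j ≡ lookupD default σ j) →
    build (pathStep f ρ) k ≡ build (pathStep f σ) k
  build-pathStep-cong ρ σ k same = build-cong k λ j j<k _ →
    cong (λ a → applyAction a (f j (build (pathStep f ρ) j))) (same j j<k)

  build-defaultPath : ∀ n k → build (pathStep f (defaultPath n)) k ≡ build f k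
  build-defaultPath n k = build-cong k λ j _ _ →
    cong (λ a → applyAction a (f j (build (pathStep f (defaultPath n)) j))) (lookupD-defaultPath n j)

  label-nodeAt-suc : ∀ {n} (ρ : MaxPath n) j → label f (nodeAt f ρ (suc j)) ≡ actionLabel (lookupD default ρ j)
  label-nodeAt-suc ρ j
    rewrite last-∷ʳ (pathStep f ρ j (build (pathStep f ρ) j)) (build (pathStep f ρ) j)
          | init-∷ʳ (pathStep f ρ j (build (pathStep f ρ) j)) (build (pathStep f ρ) j)
          = applyAction-xor (lookupD default ρ j) (f j (build (pathStep f ρ) j))

  reachedByDefault⇔ : ∀ {n} (ρ : MaxPath n) j →
    (last (build (pathStep f ρ) (suc j)) ≡ f j (init (build (pathStep f ρ) (suc j))))
      ⇔ (lookupD default ρ j ≡ default)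
  reachedByDefault⇔ ρ j
    rewrite last-∷ʳ (pathStep f ρ j (build (pathStep f ρ) j)) (build (pathStep f ρ) j)
          | init-∷ʳ (pathStep f ρ j (build (pathStep f ρ) j)) (build (pathStep f ρ) j)
          = applyAction-fixes⇔ (lookupD default ρ j) (f j (build (pathStep f ρ) j))

  actionLabels : ∀ {n} → MaxPath n → (k : ℕ) → Vec Label k
  actionLabels ρ zero    = []
  actionLabels ρ (suc k) = actionLabels ρ k ∷ʳ actionLabel (lookupD default ρ k)

  actionLabels-∷ : ∀ {n} a (ρ : MaxPath n) k → actionLabels (a ∷ ρ) (suc k) ≡ actionLabel a ∷ actionLabels ρ k
  actionLabels-∷ a ρ zero    = refl
  actionLabels-∷ a ρ (suc k) = cong (_∷ʳ actionLabel (lookupD default ρ k)) (actionLabels-∷ a ρ k)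

  actionLabels-full : ∀ {n} (ρ : MaxPath n) → actionLabels ρ n ≡ map actionLabel ρ
  actionLabels-full []      = refl
  actionLabels-full (a ∷ ρ) = trans (actionLabels-∷ a ρ _) (cong (actionLabel a ∷_) (actionLabels-full ρ))

  labelsUpTo-actionLabels : ∀ {n} (ρ : MaxPath n) k → labelsUpTo f ρ k ≡ unlabeled ∷ actionLabels ρ k
  labelsUpTo-actionLabels ρ zero    = refl
  labelsUpTo-actionLabels ρ (suc k) = cong₂ _∷ʳ_ (labelsUpTo-actionLabels ρ k) (label-nodeAt-suc ρ k)

  labelsUpTo-maxPath : ∀ {n} (ρ : MaxPath n) → labelsUpTo f ρ n ≡ unlabeled ∷ map actionLabel ρ
  labelsUpTo-maxPath ρ = trans (labelsUpTo-actionLabels ρ _) (cong (unlabeled ∷_) (actionLabels-full ρ))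

  hamming-defaultPath : ∀ {n} (ρ : MaxPath n) →
    hamming (map actionLabel (defaultPath n)) (map actionLabel ρ) ≡ interventions ρ
  hamming-defaultPath []                 = refl
  hamming-defaultPath (default ∷ ρ)      = hamming-defaultPath ρ
  hamming-defaultPath (intervention ∷ ρ) = cong suc (hamming-defaultPath ρ)

  dHamm-defaultPath : ∀ n (ρ : MaxPath n) → dHamm f (defaultPath n) ρ ≡ interventions ρ
  dHamm-defaultPath n ρ = begin
    hamming (labelsUpTo f (defaultPath n) n) (labelsUpTo f ρ n)
      ≡⟨ cong₂ hamming (labelsUpTo-maxPath (defaultPath n)) (labelsUpTo-maxPath ρ) ⟩
    hamming (map actionLabel (defaultPath n)) (map actionLabel ρ)
      ≡⟨ hamming-defaultPath ρ ⟩
    interventions ρ ∎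

  module _ {n} (X : Subset n) where

    visits-CX⇔ : ∀ ρ → Visits f ρ (CX n f X) ⇔
      (∃ λ j → j < n × lookupD false X j ≡ true × lookupD default ρ j ≡ default)
    visits-CX⇔ ρ = mk⇔ to from
      where
      to : Visits f ρ (CX n f X) → ∃ λ j → j < n × lookupD false X j ≡ true × lookupD default ρ j ≡ default
      to (suc j , _ , j<n , Xj , byDefault) = j , j<n , Xj , Equivalence.to (reachedByDefault⇔ ρ j) byDefault
      from : (∃ λ j → j < n × lookupD false X j ≡ true × lookupD default ρ j ≡ default) → Visits f ρ (CX n f X)
      from (j , j<n , Xj , ρj) = suc j , j<n , j<n , Xj , Equivalence.from (reachedByDefault⇔ ρ j) ρj

    avoids-CX⇔ : ∀ ρ → (¬ Visits f ρ (CX n f X)) ⇔ IntervenesOn X ρ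
    avoids-CX⇔ ρ = mk⇔ to from
      where
      to : ¬ Visits f ρ (CX n f X) → IntervenesOn X ρ
      to avoids j j<n Xj with lookupD default ρ j in ρj
      ... | intervention = refl
      ... | default      = ⊥-elim (avoids (Equivalence.from (visits-CX⇔ ρ) (j , j<n , Xj , ρj)))
      from : IntervenesOn X ρ → ¬ Visits f ρ (CX n f X)
      from onX visit with Equivalence.to (visits-CX⇔ ρ) visit
      ... | j , j<n , Xj , ρj with trans (sym ρj) (onX j j<n Xj)
      ...   | ()

module _ {n} (f : SEM) (X : Subset n) (α : Vec Bool n) where

  intervene-empty : (∀ j → lookupD false X j ≡ false) → ∀ k → build (intervene f X α) k ≡ build f k
  intervene-empty empty k = build-cong k λ j _ _ →
    cong (λ b → if b then lookupD false α j else f j (build (intervene f X α) j)) (empty j)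

  intervention-redundant : ∀ i → lookupD false X i ≡ true →
    lookupD false α i ≡ f i (build (intervene f X α) i) →
    ∀ k → build (intervene f X α) k ≡ build (intervene f (setAt i false X) α) k
  intervention-redundant i Xi αi≡fi k = build-cong k step
    where
    step : ∀ j → j < k → build (intervene f X α) j ≡ build (intervene f (setAt i false X) α) j →
      intervene f X α j (build (intervene f X α) j) ≡ intervene f (setAt i false X) α j (build (intervene f X α) j)
    step j _ _ with j ≟ i
    ... | no j≢i = cong (λ b → if b then lookupD false α j else f j (build (intervene f X α) j))
                        (sym (lookupD-setAt-≢ false false X j≢i))
    ... | yes refl = begin
      (if lookupD false X j then lookupD false α j else f j s)
        ≡⟨ cong (λ b → if b then lookupD false α j else f j s) Xi ⟩
      lookupD false α j
        ≡⟨ αi≡fi ⟩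
      f j s
        ≡⟨ cong (λ b → if b then lookupD false α j else f j s) (lookupD-setAt-≡ false X j) ⟨
      (if lookupD false (setAt j false X) j then lookupD false α j else f j s) ∎
      where
      s : Vec Bool j
      s = build (intervene f X α) j

  intervene-flipping :
    (∀ i → i < n → lookupD false X i ≡ true → lookupD false α i ≡ not (f i (build (intervene f X α) i))) →
    build (intervene f X α) n ≡ build (pathStep f (actionsOf X)) n
  intervene-flipping flips = build-cong n step
    where
    step : ∀ i → i < n → build (intervene f X α) i ≡ build (pathStep f (actionsOf X)) i →
      intervene f X α i (build (intervene f X α) i) ≡ pathStep f (actionsOf X) i (build (intervene f X α) i)
    step i i<n _ rewrite lookupD-actionsOf X i with lookupD false X i in Xi
    ... | true  = flips i i<n Xi
    ... | false = refl

  minimal-flips : ∀ (E : Vec Bool n → Set) → ¬ E (build (intervene f X α) n) →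
    (∀ Y → Y ⊂ X → ¬ HasButForProperty n f E Y) →
    ∀ i → i < n → lookupD false X i ≡ true → lookupD false α i ≡ not (f i (build (intervene f X α) i))
  minimal-flips E leavesE minimal i i<n Xi = ¬-not λ αi≡fi →
    minimal (setAt i false X) (setAt-false-⊂ X i<n Xi)
      (α , λ inE → leavesE (subst E (sym (intervention-redundant i Xi αi≡fi n)) inE))

butFor-nonempty : ∀ {n} (f : SEM) (E : Vec Bool n → Set) (X : Subset n) → E (build f n) →
  HasButForProperty n f E X → ∃ λ j → j < n × lookupD false X j ≡ true
butFor-nonempty {n} f E X inE (α , leavesE) with some-true-or-all-false X
... | inj₁ member = member
... | inj₂ empty  = ⊥-elim (leavesE (subst E (sym (intervene-empty f X α empty n)) inE))

closest-avoider-run : ∀ {n} (f : SEM) (X : Subset n) (ρ : MaxPath n) → ¬ Visits f ρ (CX n f X) →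
  (∀ ρ' → ¬ Visits f ρ' (CX n f X) → dHamm f (defaultPath n) ρ ≤ dHamm f (defaultPath n) ρ') →
  build (pathStep f ρ) n ≡ build (pathStep f (actionsOf X)) n
closest-avoider-run {n} f X ρ avoidsρ closest = build-pathStep-cong f ρ (actionsOf X) n λ j j<n →
  trans (closest-intervener-on-X X ρ (to (avoids-CX⇔ f X ρ) avoidsρ) fewest j j<n)
        (sym (lookupD-actionsOf X j))
  where
  open Equivalence
  fewest : ∀ ρ' → IntervenesOn X ρ' → interventions ρ ≤ interventions ρ'
  fewest ρ' onX = subst₂ _≤_ (dHamm-defaultPath f n ρ) (dHamm-defaultPath f n ρ')
                    (closest ρ' (from (avoids-CX⇔ f X ρ') onX))

proposition10 : (n : ℕ) (f : SEM) (E : Vec Bool n → Set) → E (build f n)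
    → (X : Subset n) → ButForCause n f E X
    → CounterfactualCause n f (CX n f X) (LeafSet n E) (defaultPath n)
proposition10 n f E inE X ((α , leavesE) , minimal) =
    visitsCause
  , visitsEffect
  , (actionsOf X , from (avoids-CX⇔ f X (actionsOf X)) (intervenesOn-actionsOf X))
  , closest-misses
  where
  open Equivalence
  visitsCause : Visits f (defaultPath n) (CX n f X)
  visitsCause with butFor-nonempty f E X inE (α , leavesE)
  ... | j , j<n , Xj = from (visits-CX⇔ f X (defaultPath n)) (j , j<n , Xj , lookupD-defaultPath n j)

  visitsEffect : Visits f (defaultPath n) (LeafSet n E)
  visitsEffect = n , ≤-refl , refl , subst E (sym (build-defaultPath f n n)) inE

  closest-misses : ∀ ρ → ¬ Visits f ρ (CX n f X) →
    (∀ ρ' → ¬ Visits f ρ' (CX n f X) → dHamm f (defaultPath n) ρ ≤ dHamm f (defaultPath n) ρ') →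
    ¬ Visits f ρ (LeafSet n E)
  closest-misses ρ avoidsρ closest (_ , _ , refl , inE) = leavesE (subst E leaf inE)
    where
    leaf : build (pathStep f ρ) n ≡ build (intervene f X α) n
    leaf = trans (closest-avoider-run f X ρ avoidsρ closest)
                 (sym (intervene-flipping f X α (minimal-flips f X α E leavesE minimal)))
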